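{- Let $G$ be a split graph with clusters indexed as in the context, and let $I_s, I_t$ be typical independent sets of $G$, each having at least one Free cluster, such that $i(I_s) \neq i(I_t)$. If $I_s \rightsquigarrow_2 I_t$, then both of the following hold: (1) for some $k_1 \in \{0,1,2\}$, $|N_{i(I_s)}| \geq k_1$ and $|U^B| \geq |I_s| + |N_{i(I_s)}| + |N_0| - k_1$; (2) for some $k_2 \in \{0,1,2\}$, $|N_{i(I_t)}| \geq k_2$ and $|U^B| \geq |I_t| + |N_{i(I_t)}| + |N_0| - k_2$.
   Context: For independent sets $I, J$ of $G$, write $I \leftrightarrow_2 J$ if $|I \setminus J| = |J \setminus I| = 1$ and $\mathrm{dist}_G(u,v) \le 2$ where $I \setminus J = \{u\}$, $J \setminus I = \{v\}$; write $I \rightsquigarrow_2 J$ if there is a finite sequence $I = I_0, \dots, I_\ell = J$ ($\ell \ge 0$) of independent sets with $I_j \leftrightarrow_2 I_{j+1}$ for all $j$. Setting: $G$ is a split graph with vertex set partitioned as $V^A \cup U^B$, where $V^A$ is a clique and $U^B$ is an independent set, and every vertex of $U^B$ has a neighbor in $V^A$. Let $V^B \subseteq V^A$ be the set of vertices of $V^A$ having a neighbor in $U^B$, and let $G^B$ be the bipartite graph with parts $V^B$ and $U^B$ whose edges are the edges of $G$ between $V^A$ and $U^B$. A cluster is a connected component of $G^B$, written $(U_C, V_C, E_C)$ with $U_C \subseteq U^B$, $V_C \subseteq V^B$; in addition, if $V' = V^A \setminus V^B \neq \emptyset$, then $(\emptyset, V', \emptyset)$ is also a cluster. For each cluster fix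 a vertex of minimum degree in the cluster among its vertices in $V_C$, and let $N_C$ be its neighborhood inside the cluster. The clusters are indexed $C_0, \dots, C_{m-1}$, $C_i = (U_i, V_i, E_i)$, $N_i = N_{C_i}$, so that $|N_0| \le |N_1| \le \dots \le |N_{m-1}|$. A typical independent set is an independent set $I$ of $G$ with $I \cap V^A = \emptyset$; its distribution is $(|I \cap U_i|)_{0 \le i \le m-1}$. For a typical independent set $I$, let $\phi_i(I) = \min\{|N_i \cap J| : J \text{ a typical independent set with the same distribution as } I\}$; $C_i$ is Free for $I$ if $\phi_i(I) = 0$. For $I$ having a Free cluster, $i(I)$ denotes the minimum index $i$ such that $C_i$ is Free for $I$. -}

module Defs where

open import Data.Nat using (ℕ; zero; suc; _≤_)
open import Data.Fin using (Fin; _≟_) renaming (zero to fzero; _<_ to _<ᶠ_; _≤_ to _≤ᶠ_)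
open import Data.Fin.Subset using (Subset; _∈_; _∩_; _─_; ∣_∣; ⁅_⁆)
open import Data.Bool using (Bool; true; false; T; not; _∧_; _∨_)
open import Data.Vec using (tabulate)
open import Data.Product using (∃-syntax; _×_)
open import Data.Sum using (_⊎_)
open import Relation.Nullary using (¬_)
open import Relation.Nullary.Decidable using (⌊_⌋)
open import Relation.Binary.PropositionalEquality using (_≡_; _≢_)
open import Relation.Binary.Construct.Closure.ReflexiveTransitive using (Star)

record Graph : Set where
  field
    n      : ℕ
    adj    : Fin n → Fin n → Bool
    sym    : ∀ u v → adj u v ≡ adj v u
    irrefl : ∀ v → adj v v ≡ false
open Graph public

Adj : (G : Graph) → Fin (n G) → Fin (n G) → Set
Adj G u v = T (adj G u v)

Dist≤2 : (G : Graph) → Fin (n G) → Fin (n G) → Set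
Dist≤2 G u v = (u ≡ v) ⊎ (Adj G u v ⊎ (∃[ w ] (Adj G u w × Adj G w v)))

Independent : (G : Graph) → Subset (n G) → Set
Independent G I = ∀ u v → u ∈ I → v ∈ I → ¬ Adj G u v

Step₂ : (G : Graph) → Subset (n G) → Subset (n G) → Set
Step₂ G I J = Independent G I × Independent G J ×
  (∃[ u ] ∃[ v ] ((I ─ J) ≡ ⁅ u ⁆ × (J ─ I) ≡ ⁅ v ⁆ × Dist≤2 G u v))

Reach₂ : (G : Graph) → Subset (n G) → Subset (n G) → Set
Reach₂ G = Star (Step₂ G)

-- Split graphs.  inA v = true ⇔ v ∈ V^A ;  inA v = false ⇔ v ∈ U^B.

record SplitGraph : Set where
  field
    G       : Graph
    inA     : Fin (n G) → Bool
    cliqueA : ∀ u v → T (inA u) → T (inA v) → u ≢ v → Adj G u v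
    indepB  : ∀ u v → T (not (inA u)) → T (not (inA v)) → ¬ Adj G u v
    coverB  : ∀ u → T (not (inA u)) → ∃[ v ] (T (inA v) × Adj G u v)
open SplitGraph public

module _ (S : SplitGraph) where
  private
    V = Fin (n (G S))

  EdgeB : V → V → Set
  EdgeB u v = Adj (G S) u v × T ((inA S u ∧ not (inA S v)) ∨ (not (inA S u) ∧ inA S v))

  InVB : V → Set
  InVB v = T (inA S v) × ∃[ u ] (T (not (inA S u)) × Adj (G S) v u)

  InV' : V → Set
  InV' v = T (inA S v) × (∀ u → T (not (inA S u)) → ¬ Adj (G S) v u)

  InGB : V → Set
  InGB v = T (not (inA S v)) ⊎ InVB v

  ConnB : V → V → Set
  ConnB = Star EdgeB

  NbB : V → Subset (n (G S))
  NbB v = tabulate (λ u → not (inA S u) ∧ adj (G S) v u)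

  UB : Subset (n (G S))
  UB = tabulate (λ u → not (inA S u))

  Typical : Subset (n (G S)) → Set
  Typical I = Independent (G S) I × (∀ v → v ∈ I → T (not (inA S v)))

record Clustering (S : SplitGraph) : Set where
  field
    m      : ℕ
    cl     : Fin (n (G S)) → Fin m
    -- clusters of G^B are exactly the connected components of G^B
    clConn : ∀ u v → InGB S u → InGB S v →
               (cl u ≡ cl v → ConnB S u v) × (ConnB S u v → cl u ≡ cl v)
    -- V' (when nonempty) is one additional cluster
    clV'   : ∀ u v → InV' S u → (cl u ≡ cl v → InV' S v) × (InV' S v → cl u ≡ cl v)
    clSurj : ∀ i → ∃[ v ] (cl v ≡ i)
    rep    : Fin m → Fin (n (G S))
    repIn  : ∀ i → T (inA S (rep i)) × cl (rep i) ≡ i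
    repMin : ∀ i v → T (inA S v) → cl v ≡ i → ∣ NbB S (rep i) ∣ ≤ ∣ NbB S v ∣
    sorted : ∀ i j → i ≤ᶠ j → ∣ NbB S (rep i) ∣ ≤ ∣ NbB S (rep j) ∣
open Clustering public

module _ {S : SplitGraph} (C : Clustering S) where
  private
    VS = Subset (n (G S))

  N : Fin (m C) → VS
  N i = NbB S (rep C i)

  U : Fin (m C) → VS
  U i = tabulate (λ u → not (inA S u) ∧ ⌊ cl C u ≟ i ⌋)

  SameDist : VS → VS → Set
  SameDist I J = ∀ i → ∣ I ∩ U i ∣ ≡ ∣ J ∩ U i ∣

  IsPhi : VS → Fin (m C) → ℕ → Set
  IsPhi I i k =
    (∃[ J ] (Typical S J × SameDist J I × ∣ N i ∩ J ∣ ≡ k)) ×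
    (∀ J → Typical S J → SameDist J I → k ≤ ∣ N i ∩ J ∣)

  Free : Fin (m C) → VS → Set
  Free i I = IsPhi I i 0

  IsFirstFree : VS → Fin (m C) → Set
  IsFirstFree I i = Free i I × (∀ j → j <ᶠ i → ¬ Free j I)

-- the index 0 (exists whenever some index exists)
fin0 : ∀ {m} → Fin m → Fin m
fin0 {suc m} _ = fzero

{-# OPTIONS --safe #-}
module Submission where

-- Along a ↔₂-path every set keeps the size |Is| and, being independent, meets the clique V^A in at
-- most one vertex.  Let i be a Free cluster of Is and suppose |Is| + |N_i| + |N_0| > |U^B| + 2.
-- Then every set X of the path satisfies |X ∩ U_i| + |N_i| ≤ |U_i| + 1: a token moving inside U^B
-- cannot change cluster (distance 2 goes through a common neighbour in V^A); a vertex w ∈ V^A of X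
-- keeps its at least |N_{cl w}| neighbours in U_{cl w} free of tokens; and w must lie in C_i, since
-- otherwise its at least |N_0| neighbours outside U_i would not fit next to the tokens in U^B.
-- At It, Free for a cluster j ≠ i, the same count gives |It| + |N_i| + |N_j| ≤ |U^B| + 1, which is
-- absurd.  The remaining slack of at most 2 is absorbed by k = min(|N_i|, 2), as
-- |Is| + |N_i| ≤ |U^B|.

open import Defs hiding (sym)
open import Data.Nat using (ℕ; suc; _+_; _∸_; _≤_; _<_; _⊓_; _≤?_; s≤s; z≤n)
open import Data.Nat.Properties
  using (+-suc; +-assoc; +-comm; +-mono-≤; +-monoˡ-≤; +-monoʳ-≤; ≤-trans; ≤-reflexive; n≮0; n≤1+n;
         <⇒≱; ≰⇒>; m⊓n≤m; m⊓n≤n; ⊓-glb; +-distribʳ-⊓; m≤n+o⇒m∸n≤o; module ≤-Reasoning)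
open import Data.Nat.Tactic.RingSolver using (solve-∀)
open import Data.Fin using (Fin; _≟_) renaming (_≤_ to _≤ᶠ_)
open import Data.Fin.Subset using (Subset; _∈_; _∉_; _⊆_; _∩_; _─_; _-_; ∣_∣; ⁅_⁆; inside; outside)
open import Data.Fin.Subset.Properties
  using (_∈?_; ⊆-refl; p⊆q⇒∣p∣≤∣q∣; ∣p∩q∣≤∣q∣; ∣⁅x⁆∣≡1; x∈⁅x⁆; x∈⁅y⁆⇒x≡y; x∉⁅y⁆⇒x≢y; x∈p∩q⁺; x∈p∩q⁻;
         p∩q⊆q; ∩-comm; x∈p∧x∉q⇒x∈p─q; p─q⊆p; x∈p⇒∣p-x∣<∣p∣; x∈p∧x≢y⇒x∈p-y; ∉⊥; p─⊥≡p)
open import Data.Bool using (Bool; true; false; T; not)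
open import Data.Bool.Properties using (T-∧; T-∨; T-≡)
open import Data.Vec using (_∷_; []; here; there; tabulate)
open import Data.Vec.Properties using (lookup⇒[]=; []=⇒lookup; lookup∘tabulate)
open import Data.Product using (∃-syntax; _×_; _,_; proj₁; proj₂)
open import Data.Sum using (_⊎_; inj₁; inj₂; map₂)
open import Data.Empty using (⊥; ⊥-elim)
open import Function using (_∘_)
open import Function.Bundles using (module Equivalence)
open import Relation.Binary.Definitions using (Symmetric)
open import Relation.Nullary using (yes; no; contradiction)
open import Relation.Nullary.Decidable using (toWitness; fromWitness)
open import Relation.Binary.PropositionalEquality
  using (_≡_; _≢_; refl; sym; trans; cong; subst; subst₂; module ≡-Reasoning)
open import Relation.Binary.Construct.Closure.ReflexiveTransitive using (ε; _◅_; reverse)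

open Equivalence using (to; from)

private
  variable
    k : ℕ
    x y : Fin k
    p q r : Subset k

x∈p─q⇒x∉q : x ∈ p ─ q → x ∉ q
x∈p─q⇒x∉q {p = _ ∷ _} {q = outside ∷ _} here       ()
x∈p─q⇒x∉q {p = _ ∷ _} {q = _ ∷ _}       (there x∈) (there x∈q) = x∈p─q⇒x∉q x∈ x∈q

x∈p-y⇒x≢y : x ∈ p - y → x ≢ y
x∈p-y⇒x≢y x∈ = x∉⁅y⁆⇒x≢y (x∈p─q⇒x∉q x∈)

∩-monoˡ-⊆ : p ⊆ q → p ∩ r ⊆ q ∩ r
∩-monoˡ-⊆ {p = p} {r = r} p⊆q x∈ = let x∈p , x∈r = x∈p∩q⁻ p r x∈ in x∈p∩q⁺ (p⊆q x∈p , x∈r)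

─-monoˡ-⊆ : p ⊆ q → p ─ r ⊆ q ─ r
─-monoˡ-⊆ p⊆q x∈ = x∈p∧x∉q⇒x∈p─q (p⊆q (p─q⊆p _ _ x∈)) (x∈p─q⇒x∉q x∈)

⊆-∩⁺ : p ⊆ q → p ⊆ r → p ⊆ q ∩ r
⊆-∩⁺ p⊆q p⊆r x∈p = x∈p∩q⁺ (p⊆q x∈p , p⊆r x∈p)

⊆-─⁺ : p ⊆ q → (∀ {x} → x ∈ p → x ∉ r) → p ⊆ q ─ r
⊆-─⁺ p⊆q p∩r=∅ x∈p = x∈p∧x∉q⇒x∈p─q (p⊆q x∈p) (p∩r=∅ x∈p)

∣p∣≡∣p∩q∣+∣p─q∣ : ∀ (p q : Subset k) → ∣ p ∣ ≡ ∣ p ∩ q ∣ + ∣ p ─ q ∣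
∣p∣≡∣p∩q∣+∣p─q∣ []            []            = refl
∣p∣≡∣p∩q∣+∣p─q∣ (inside  ∷ p) (inside  ∷ q) = cong suc (∣p∣≡∣p∩q∣+∣p─q∣ p q)
∣p∣≡∣p∩q∣+∣p─q∣ (inside  ∷ p) (outside ∷ q) =
  trans (cong suc (∣p∣≡∣p∩q∣+∣p─q∣ p q)) (sym (+-suc _ _))
∣p∣≡∣p∩q∣+∣p─q∣ (outside ∷ p) (inside  ∷ q) = ∣p∣≡∣p∩q∣+∣p─q∣ p q
∣p∣≡∣p∩q∣+∣p─q∣ (outside ∷ p) (outside ∷ q) = ∣p∣≡∣p∩q∣+∣p─q∣ p q

∣p∣≤1+∣p-x∣ : ∀ (p : Subset k) x → ∣ p ∣ ≤ 1 + ∣ p - x ∣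
∣p∣≤1+∣p-x∣ p x = begin
  ∣ p ∣                     ≡⟨ ∣p∣≡∣p∩q∣+∣p─q∣ p ⁅ x ⁆ ⟩
  ∣ p ∩ ⁅ x ⁆ ∣ + ∣ p - x ∣ ≤⟨ +-monoˡ-≤ ∣ p - x ∣ ∣p∩⁅x⁆∣≤1 ⟩
  1 + ∣ p - x ∣             ∎
  where
  open ≤-Reasoning
  ∣p∩⁅x⁆∣≤1 : ∣ p ∩ ⁅ x ⁆ ∣ ≤ 1
  ∣p∩⁅x⁆∣≤1 = ≤-trans (∣p∩q∣≤∣q∣ p ⁅ x ⁆) (≤-reflexive (∣⁅x⁆∣≡1 x))

p-x⊆q⇒∣p∣≤1+∣q∣ : p - x ⊆ q → ∣ p ∣ ≤ 1 + ∣ q ∣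
p-x⊆q⇒∣p∣≤1+∣q∣ {p = p} {x = x} p-x⊆q = ≤-trans (∣p∣≤1+∣p-x∣ p x) (s≤s (p⊆q⇒∣p∣≤∣q∣ p-x⊆q))

p-x⊆q-y⇒∣p∣≤∣q∣ : p - x ⊆ q - y → y ∈ q → ∣ p ∣ ≤ ∣ q ∣
p-x⊆q-y⇒∣p∣≤∣q∣ p-x⊆q-y y∈q = ≤-trans (p-x⊆q⇒∣p∣≤1+∣q∣ p-x⊆q-y) (x∈p⇒∣p-x∣<∣p∣ y∈q)

∣p∩q∣≡0⇒x∈p⇒x∉q : ∣ p ∩ q ∣ ≡ 0 → x ∈ p → x ∉ q
∣p∩q∣≡0⇒x∈p⇒x∉q {p = p} {q = q} {x = x} ∣p∩q∣≡0 x∈p x∈q =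
  n≮0 (subst (∣ p ∩ q - x ∣ <_) ∣p∩q∣≡0 (x∈p⇒∣p-x∣<∣p∣ (x∈p∩q⁺ (x∈p , x∈q))))

disjoint⇒∣p∣+∣q∣≤∣r∣ : (∀ {x} → x ∈ p → x ∉ q) → p ⊆ r → q ⊆ r → ∣ p ∣ + ∣ q ∣ ≤ ∣ r ∣
disjoint⇒∣p∣+∣q∣≤∣r∣ {p = p} {q = q} {r = r} disjoint p⊆r q⊆r = begin
  ∣ p ∣ + ∣ q ∣         ≤⟨ +-mono-≤ (p⊆q⇒∣p∣≤∣q∣ (⊆-∩⁺ p⊆r ⊆-refl))
                                    (p⊆q⇒∣p∣≤∣q∣ (⊆-─⁺ q⊆r λ x∈q x∈p → disjoint x∈p x∈q)) ⟩
  ∣ r ∩ p ∣ + ∣ r ─ p ∣ ≡⟨ sym (∣p∣≡∣p∩q∣+∣p─q∣ r p) ⟩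
  ∣ r ∣                 ∎
  where open ≤-Reasoning

∣p∩r∣+a≤∣q∩r∣⇒∣p∣+a≤∣q∣ : p ⊆ q → ∀ {a} → ∣ p ∩ r ∣ + a ≤ ∣ q ∩ r ∣ → ∣ p ∣ + a ≤ ∣ q ∣
∣p∩r∣+a≤∣q∩r∣⇒∣p∣+a≤∣q∣ {p = p} {q = q} {r = r} p⊆q {a} in-r = begin
  ∣ p ∣ + a                     ≡⟨ cong (_+ a) (∣p∣≡∣p∩q∣+∣p─q∣ p r) ⟩
  ∣ p ∩ r ∣ + ∣ p ─ r ∣ + a     ≡⟨ +-rearrange ∣ p ∩ r ∣ ∣ p ─ r ∣ a ⟩
  ∣ p ∩ r ∣ + a + ∣ p ─ r ∣     ≤⟨ +-mono-≤ in-r (p⊆q⇒∣p∣≤∣q∣ (─-monoˡ-⊆ {r = r} p⊆q)) ⟩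
  ∣ q ∩ r ∣ + ∣ q ─ r ∣         ≡⟨ sym (∣p∣≡∣p∩q∣+∣p─q∣ q r) ⟩
  ∣ q ∣                         ∎
  where
  open ≤-Reasoning
  +-rearrange : ∀ b c d → b + c + d ≡ b + d + c
  +-rearrange = solve-∀

∣p∩r∣+a≤c+∣r∣⇒∣p∣+a+b≤c+∣q∣ : ∀ (p q r : Subset k) {a b c} → r ⊆ q →
  ∣ p ∩ r ∣ + a ≤ c + ∣ r ∣ → ∣ p ─ r ∣ + b ≤ ∣ q ─ r ∣ → ∣ p ∣ + a + b ≤ c + ∣ q ∣
∣p∩r∣+a≤c+∣r∣⇒∣p∣+a+b≤c+∣q∣ p q r {a} {b} {c} r⊆q in-r off-r = begin
  ∣ p ∣ + a + b                         ≡⟨ cong (λ t → t + a + b) (∣p∣≡∣p∩q∣+∣p─q∣ p r) ⟩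
  ∣ p ∩ r ∣ + ∣ p ─ r ∣ + a + b         ≡⟨ +-rearrange ∣ p ∩ r ∣ ∣ p ─ r ∣ a b ⟩
  (∣ p ∩ r ∣ + a) + (∣ p ─ r ∣ + b)     ≤⟨ +-mono-≤ in-r off-r ⟩
  (c + ∣ r ∣) + ∣ q ─ r ∣               ≤⟨ +-monoˡ-≤ ∣ q ─ r ∣ (+-monoʳ-≤ c ∣r∣≤∣q∩r∣) ⟩
  (c + ∣ q ∩ r ∣) + ∣ q ─ r ∣           ≡⟨ +-assoc c ∣ q ∩ r ∣ ∣ q ─ r ∣ ⟩
  c + (∣ q ∩ r ∣ + ∣ q ─ r ∣)           ≡⟨ cong (c +_) (sym (∣p∣≡∣p∩q∣+∣p─q∣ q r)) ⟩
  c + ∣ q ∣                             ∎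
  where
  open ≤-Reasoning
  +-rearrange : ∀ e f g h → e + f + g + h ≡ (e + g) + (f + h)
  +-rearrange = solve-∀
  ∣r∣≤∣q∩r∣ : ∣ r ∣ ≤ ∣ q ∩ r ∣
  ∣r∣≤∣q∩r∣ = p⊆q⇒∣p∣≤∣q∣ (⊆-∩⁺ r⊆q ⊆-refl)

p─q≡⁅x⁆⇒x∈p : p ─ q ≡ ⁅ x ⁆ → x ∈ p
p─q≡⁅x⁆⇒x∈p {p = p} {q = q} {x = x} p─q≡x = p─q⊆p p q (subst (x ∈_) (sym p─q≡x) (x∈⁅x⁆ x))

p─q≡⁅x⁆⇒x∉q : p ─ q ≡ ⁅ x ⁆ → x ∉ q
p─q≡⁅x⁆⇒x∉q {x = x} p─q≡x = x∈p─q⇒x∉q (subst (x ∈_) (sym p─q≡x) (x∈⁅x⁆ x))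

p─q≡⁅x⁆⇒p-x⊆q : p ─ q ≡ ⁅ x ⁆ → p - x ⊆ q
p─q≡⁅x⁆⇒p-x⊆q {q = q} {x = x} p─q≡x {y} y∈p-x with y ∈? q
... | yes y∈q = y∈q
... | no  y∉q = contradiction
  (x∈⁅y⁆⇒x≡y x (subst (y ∈_) p─q≡x (x∈p∧x∉q⇒x∈p─q (p─q⊆p _ _ y∈p-x) y∉q)))
  (x∈p-y⇒x≢y y∈p-x)

p-x⊆q⇒p∩r-x⊆q∩r : p - x ⊆ q → p ∩ r - x ⊆ q ∩ r
p-x⊆q⇒p∩r-x⊆q∩r {p = p} {r = r} p-x⊆q y∈ =
  let y∈p , y∈r = x∈p∩q⁻ p r (p─q⊆p _ _ y∈)
  in  x∈p∩q⁺ (p-x⊆q (x∈p∧x≢y⇒x∈p-y y∈p (x∈p-y⇒x≢y y∈)) , y∈r)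

p─q≡⁅x⁆⇒∣p∣≡∣p∩q∣+1 : p ─ q ≡ ⁅ x ⁆ → ∣ p ∣ ≡ ∣ p ∩ q ∣ + 1
p─q≡⁅x⁆⇒∣p∣≡∣p∩q∣+1 {p = p} {q = q} {x = x} p─q≡x =
  trans (∣p∣≡∣p∩q∣+∣p─q∣ p q) (cong (∣ p ∩ q ∣ +_) (trans (cong ∣_∣ p─q≡x) (∣⁅x⁆∣≡1 x)))

exchange-∣∣ : p ─ q ≡ ⁅ x ⁆ → q ─ p ≡ ⁅ y ⁆ → ∣ p ∣ ≡ ∣ q ∣
exchange-∣∣ {p = p} {q = q} p─q≡x q─p≡y = begin
  ∣ p ∣         ≡⟨ p─q≡⁅x⁆⇒∣p∣≡∣p∩q∣+1 p─q≡x ⟩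
  ∣ p ∩ q ∣ + 1 ≡⟨ cong (λ s → ∣ s ∣ + 1) (∩-comm p q) ⟩
  ∣ q ∩ p ∣ + 1 ≡⟨ sym (p─q≡⁅x⁆⇒∣p∣≡∣p∩q∣+1 q─p≡y) ⟩
  ∣ q ∣         ∎
  where open ≡-Reasoning

exchange-∣∩∣≤1+ : q ─ p ≡ ⁅ y ⁆ → ∀ r → ∣ q ∩ r ∣ ≤ 1 + ∣ p ∩ r ∣
exchange-∣∩∣≤1+ q─p≡y r = p-x⊆q⇒∣p∣≤1+∣q∣ (p-x⊆q⇒p∩r-x⊆q∩r (p─q≡⁅x⁆⇒p-x⊆q q─p≡y))

exchange-∣∩∣≤ : p ─ q ≡ ⁅ x ⁆ → q ─ p ≡ ⁅ y ⁆ → ∀ r → (y ∈ r → x ∈ r) → ∣ q ∩ r ∣ ≤ ∣ p ∩ r ∣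
exchange-∣∩∣≤ {p = p} {q = q} {x = x} {y = y} p─q≡x q─p≡y r y∈r⇒x∈r with y ∈? r
... | yes y∈r = p-x⊆q-y⇒∣p∣≤∣q∣ q∩r-y⊆p∩r-x (x∈p∩q⁺ (p─q≡⁅x⁆⇒x∈p p─q≡x , y∈r⇒x∈r y∈r))
  where
  q∩r-y⊆p∩r-x : q ∩ r - y ⊆ p ∩ r - x
  q∩r-y⊆p∩r-x z∈ = x∈p∧x≢y⇒x∈p-y (p-x⊆q⇒p∩r-x⊆q∩r (p─q≡⁅x⁆⇒p-x⊆q q─p≡y) z∈)
    (λ { refl → p─q≡⁅x⁆⇒x∉q p─q≡x (proj₁ (x∈p∩q⁻ q r (p─q⊆p _ _ z∈))) })
... | no  y∉r = p⊆q⇒∣p∣≤∣q∣ q∩r⊆p∩r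
  where
  q∩r⊆p∩r : q ∩ r ⊆ p ∩ r
  q∩r⊆p∩r z∈ = let z∈q , z∈r = x∈p∩q⁻ q r z∈ in
    p-x⊆q⇒p∩r-x⊆q∩r (p─q≡⁅x⁆⇒p-x⊆q q─p≡y) (x∈p∧x≢y⇒x∈p-y z∈ (λ { refl → y∉r z∈r }))

∈-tabulate⁺ : ∀ {f : Fin k → Bool} {x} → T (f x) → x ∈ tabulate f
∈-tabulate⁺ {f = f} {x} fx = lookup⇒[]= x (tabulate f) (trans (lookup∘tabulate f x) (to T-≡ fx))

∈-tabulate⁻ : ∀ {f : Fin k → Bool} {x} → x ∈ tabulate f → T (f x)
∈-tabulate⁻ {f = f} {x} x∈ = from T-≡ (trans (sym (lookup∘tabulate f x)) ([]=⇒lookup x∈))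

T∨T-not : ∀ b → T b ⊎ T (not b)
T∨T-not true  = inj₁ _
T∨T-not false = inj₂ _

module _ {Γ : Graph} where

  Adj-sym : ∀ {u v} → Adj Γ u v → Adj Γ v u
  Adj-sym {u} {v} = subst T (Graph.sym Γ u v)

  Dist≤2-sym : ∀ {u v} → Dist≤2 Γ u v → Dist≤2 Γ v u
  Dist≤2-sym (inj₁ u≡v)                = inj₁ (sym u≡v)
  Dist≤2-sym (inj₂ (inj₁ uv))          = inj₂ (inj₁ (Adj-sym uv))
  Dist≤2-sym (inj₂ (inj₂ (w , uw , wv))) = inj₂ (inj₂ (w , Adj-sym wv , Adj-sym uw))

  Step₂-sym : Symmetric (Step₂ Γ)
  Step₂-sym (indX , indY , u , v , X─Y≡u , Y─X≡v , d) =
    indY , indX , v , u , Y─X≡v , X─Y≡u , Dist≤2-sym d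

module _ (S : SplitGraph) where

  ∈UB⁺ : ∀ {v} → T (not (inA S v)) → v ∈ UB S
  ∈UB⁺ = ∈-tabulate⁺

  ∈UB⁻ : ∀ {v} → v ∈ UB S → T (not (inA S v))
  ∈UB⁻ = ∈-tabulate⁻

  A-or-UB : ∀ v → T (inA S v) ⊎ v ∈ UB S
  A-or-UB v = map₂ ∈UB⁺ (T∨T-not (inA S v))

  ∈NbB⁻ : ∀ {w x} → x ∈ NbB S w → x ∈ UB S × Adj (G S) w x
  ∈NbB⁻ x∈ = let x∉A , wx = to T-∧ (∈-tabulate⁻ x∈) in ∈UB⁺ x∉A , wx

  independent-A-unique : ∀ {X x y} → Independent (G S) X → x ∈ X → y ∈ X →
    T (inA S x) → T (inA S y) → x ≡ y
  independent-A-unique {x = x} {y} indX x∈X y∈X x∈A y∈A with x ≟ y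
  ... | yes x≡y = x≡y
  ... | no  x≢y = contradiction (cliqueA S x y x∈A y∈A x≢y) (indX x y x∈X y∈X)

  independent⇒X-v⊆UB : ∀ {X v} → Independent (G S) X → v ∈ X → T (inA S v) → X - v ⊆ UB S
  independent⇒X-v⊆UB {X} {v} indX v∈X v∈A {x} x∈X-v with A-or-UB x
  ... | inj₁ x∈A = contradiction (independent-A-unique indX (p─q⊆p _ _ x∈X-v) v∈X x∈A v∈A)
                                 (x∈p-y⇒x≢y x∈X-v)
  ... | inj₂ x∈B = x∈B

fin0-least : ∀ {m} (i j : Fin m) → fin0 i ≤ᶠ j
fin0-least {suc _} _ _ = z≤n

module _ {S : SplitGraph} (C : Clustering S) where

  ∈U⁺ : ∀ {j x} → x ∈ UB S → cl C x ≡ j → x ∈ U C j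
  ∈U⁺ x∈B clx≡j = ∈-tabulate⁺ (from T-∧ (∈UB⁻ S x∈B , fromWitness clx≡j))

  ∈U⁻ : ∀ {j x} → x ∈ U C j → x ∈ UB S × cl C x ≡ j
  ∈U⁻ x∈ = let x∉A , clx≡j = to T-∧ (∈-tabulate⁻ x∈) in ∈UB⁺ S x∉A , toWitness clx≡j

  U⊆UB : ∀ {j} → U C j ⊆ UB S
  U⊆UB = proj₁ ∘ ∈U⁻

  U-disjoint : ∀ {i j x} → i ≢ j → x ∈ U C i → x ∉ U C j
  U-disjoint i≢j x∈Ui x∈Uj = i≢j (trans (sym (proj₂ (∈U⁻ x∈Ui))) (proj₂ (∈U⁻ x∈Uj)))

  cl-neighbour : ∀ {w x} → T (inA S w) → x ∈ UB S → Adj (G S) w x → cl C x ≡ cl C w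
  cl-neighbour {w} {x} w∈A x∈B wx =
    sym (proj₂ (clConn C w x (inj₂ (w∈A , x , ∈UB⁻ S x∈B , wx)) (inj₁ (∈UB⁻ S x∈B))) (edge ◅ ε))
    where
    edge : EdgeB S w x
    edge = wx , from T-∨ (inj₁ (from T-∧ (w∈A , ∈UB⁻ S x∈B)))

  NbB⊆U : ∀ {w} → T (inA S w) → NbB S w ⊆ U C (cl C w)
  NbB⊆U w∈A x∈ = let x∈B , wx = ∈NbB⁻ S x∈ in ∈U⁺ x∈B (cl-neighbour w∈A x∈B wx)

  N⊆U : ∀ j → N C j ⊆ U C j
  N⊆U j = subst (λ i → N C j ⊆ U C i) (proj₂ (repIn C j)) (NbB⊆U (proj₁ (repIn C j)))

  Dist≤2⇒cl≡ : ∀ {u v} → u ∈ UB S → v ∈ UB S → Dist≤2 (G S) u v → cl C u ≡ cl C v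
  Dist≤2⇒cl≡ _ _ (inj₁ refl) = refl
  Dist≤2⇒cl≡ {u} {v} u∈B v∈B (inj₂ (inj₁ uv)) = ⊥-elim (indepB S u v (∈UB⁻ S u∈B) (∈UB⁻ S v∈B) uv)
  Dist≤2⇒cl≡ {u} {v} u∈B v∈B (inj₂ (inj₂ (w , uw , wv))) with A-or-UB S w
  ... | inj₁ w∈A = trans (cl-neighbour w∈A u∈B (Adj-sym {G S} uw)) (sym (cl-neighbour w∈A v∈B wv))
  ... | inj₂ w∈B = ⊥-elim (indepB S u w (∈UB⁻ S u∈B) (∈UB⁻ S w∈B) uw)

  ∣N₀∣≤∣N∣ : ∀ i j → ∣ N C (fin0 i) ∣ ≤ ∣ N C j ∣
  ∣N₀∣≤∣N∣ i j = sorted C (fin0 i) j (fin0-least i j)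

  ∣N∣≤∣NbB∣ : ∀ {w} → T (inA S w) → ∣ N C (cl C w) ∣ ≤ ∣ NbB S w ∣
  ∣N∣≤∣NbB∣ {w} w∈A = repMin C (cl C w) w w∈A refl

  A-vertex-bound : ∀ {X w} → Independent (G S) X → w ∈ X → T (inA S w) →
    ∣ X ∩ U C (cl C w) ∣ + ∣ N C (cl C w) ∣ ≤ ∣ U C (cl C w) ∣
  A-vertex-bound {X} {w} indX w∈X w∈A = begin
    ∣ X ∩ U C (cl C w) ∣ + ∣ N C (cl C w) ∣ ≤⟨ +-monoʳ-≤ ∣ X ∩ U C (cl C w) ∣ (∣N∣≤∣NbB∣ w∈A) ⟩
    ∣ X ∩ U C (cl C w) ∣ + ∣ NbB S w ∣
      ≤⟨ disjoint⇒∣p∣+∣q∣≤∣r∣ X∩U∩Nw=∅ (p∩q⊆q X _) (NbB⊆U w∈A) ⟩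
    ∣ U C (cl C w) ∣                         ∎
    where
    open ≤-Reasoning
    X∩U∩Nw=∅ : ∀ {x} → x ∈ X ∩ U C (cl C w) → x ∉ NbB S w
    X∩U∩Nw=∅ x∈ x∈Nw = indX w _ w∈X (proj₁ (x∈p∩q⁻ X _ x∈)) (proj₂ (∈NbB⁻ S x∈Nw))

  free-bound : ∀ {j X} → Free C j X → ∣ X ∩ U C j ∣ + ∣ N C j ∣ ≤ ∣ U C j ∣
  free-bound {j} {X} ((J , _ , sameDist , ∣N∩J∣≡0) , _) = begin
    ∣ X ∩ U C j ∣ + ∣ N C j ∣ ≡⟨ cong (_+ ∣ N C j ∣) (sym (sameDist j)) ⟩
    ∣ J ∩ U C j ∣ + ∣ N C j ∣ ≤⟨ disjoint⇒∣p∣+∣q∣≤∣r∣ J∩U∩N=∅ (p∩q⊆q J _) (N⊆U j) ⟩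
    ∣ U C j ∣                 ∎
    where
    open ≤-Reasoning
    J∩U∩N=∅ : ∀ {x} → x ∈ J ∩ U C j → x ∉ N C j
    J∩U∩N=∅ x∈ x∈N = ∣p∩q∣≡0⇒x∈p⇒x∉q ∣N∩J∣≡0 x∈N (proj₁ (x∈p∩q⁻ J _ x∈))

  typical⇒⊆UB : ∀ {X} → Typical S X → X ⊆ UB S
  typical⇒⊆UB (_ , X⊆B) x∈X = ∈UB⁺ S (X⊆B _ x∈X)

  typical-free-bound : ∀ {j X R} → Typical S X → Free C j X → (∀ {x} → x ∈ U C j → x ∉ R) →
    ∣ X ─ R ∣ + ∣ N C j ∣ ≤ ∣ UB S ─ R ∣
  typical-free-bound {j} {X} {R} tyX freeX Uj∩R=∅ =
    ∣p∩r∣+a≤∣q∩r∣⇒∣p∣+a≤∣q∣ {r = U C j} (─-monoˡ-⊆ {r = R} (typical⇒⊆UB tyX)) (begin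
      ∣ (X ─ R) ∩ U C j ∣ + ∣ N C j ∣ ≤⟨ +-monoˡ-≤ ∣ N C j ∣ (p⊆q⇒∣p∣≤∣q∣ (∩-monoˡ-⊆ (p─q⊆p X R))) ⟩
      ∣ X ∩ U C j ∣ + ∣ N C j ∣       ≤⟨ free-bound {X = X} freeX ⟩
      ∣ U C j ∣                       ≤⟨ p⊆q⇒∣p∣≤∣q∣ (⊆-∩⁺ (⊆-─⁺ U⊆UB Uj∩R=∅) ⊆-refl) ⟩
      ∣ (UB S ─ R) ∩ U C j ∣          ∎)
    where open ≤-Reasoning

  typical-free⇒∣X∣+∣N∣≤∣UB∣ : ∀ {j X} → Typical S X → Free C j X → ∣ X ∣ + ∣ N C j ∣ ≤ ∣ UB S ∣
  typical-free⇒∣X∣+∣N∣≤∣UB∣ {j} {X} tyX freeX =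
    subst₂ (λ p q → ∣ p ∣ + ∣ N C j ∣ ≤ ∣ q ∣) (p─⊥≡p X) (p─⊥≡p (UB S))
      (typical-free-bound tyX freeX (λ _ → ∉⊥))

  off-cluster-bound : ∀ {Y v i} → Independent (G S) Y → v ∈ Y → T (inA S v) → cl C v ≢ i →
    ∣ Y ∩ U C i ∣ + ∣ N C i ∣ ≤ 1 + ∣ U C i ∣ →
    ∣ Y ∣ + ∣ N C i ∣ + ∣ N C (fin0 i) ∣ ≤ 2 + ∣ UB S ∣
  off-cluster-bound {Y} {v} {i} indY v∈Y v∈A clv≢i load = begin
    ∣ Y ∣ + ∣ N C i ∣ + ∣ N C (fin0 i) ∣
      ≤⟨ +-monoˡ-≤ ∣ N C (fin0 i) ∣ (+-monoˡ-≤ ∣ N C i ∣ (∣p∣≤1+∣p-x∣ Y v)) ⟩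
    1 + (∣ Y - v ∣ + ∣ N C i ∣ + ∣ N C (fin0 i) ∣)
      ≤⟨ s≤s (∣p∩r∣+a≤c+∣r∣⇒∣p∣+a+b≤c+∣q∣ (Y - v) (UB S) (U C i) U⊆UB in-Uᵢ off-Uᵢ) ⟩
    2 + ∣ UB S ∣ ∎
    where
    open ≤-Reasoning
    in-Uᵢ : ∣ (Y - v) ∩ U C i ∣ + ∣ N C i ∣ ≤ 1 + ∣ U C i ∣
    in-Uᵢ = ≤-trans (+-monoˡ-≤ ∣ N C i ∣ (p⊆q⇒∣p∣≤∣q∣ (∩-monoˡ-⊆ (p─q⊆p Y ⁅ v ⁆)))) load
    Y-v─Ui∩Nv=∅ : ∀ {x} → x ∈ Y - v ─ U C i → x ∉ NbB S v
    Y-v─Ui∩Nv=∅ x∈ x∈Nv = indY v _ v∈Y (p─q⊆p Y ⁅ v ⁆ (p─q⊆p _ _ x∈)) (proj₂ (∈NbB⁻ S x∈Nv))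
    off-Uᵢ : ∣ Y - v ─ U C i ∣ + ∣ N C (fin0 i) ∣ ≤ ∣ UB S ─ U C i ∣
    off-Uᵢ = begin
      ∣ Y - v ─ U C i ∣ + ∣ N C (fin0 i) ∣
        ≤⟨ +-monoʳ-≤ ∣ Y - v ─ U C i ∣ (≤-trans (∣N₀∣≤∣N∣ i (cl C v)) (∣N∣≤∣NbB∣ v∈A)) ⟩
      ∣ Y - v ─ U C i ∣ + ∣ NbB S v ∣
        ≤⟨ disjoint⇒∣p∣+∣q∣≤∣r∣ Y-v─Ui∩Nv=∅ (─-monoˡ-⊆ (independent⇒X-v⊆UB S indY v∈Y v∈A))
             (⊆-─⁺ (U⊆UB ∘ NbB⊆U v∈A) (U-disjoint clv≢i ∘ NbB⊆U v∈A)) ⟩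
      ∣ UB S ─ U C i ∣ ∎

module Excess {S : SplitGraph} (C : Clustering S) (i : Fin (m C)) (s : ℕ)
  (excess : 2 + ∣ UB S ∣ < s + ∣ N C i ∣ + ∣ N C (fin0 i) ∣) where

  Invariant : Subset (n (G S)) → Set
  Invariant X = ∣ X ∣ ≡ s × ∣ X ∩ U C i ∣ + ∣ N C i ∣ ≤ 1 + ∣ U C i ∣

  A-vertex-in-Cᵢ : ∀ {X v} → Independent (G S) X → Invariant X → v ∈ X → T (inA S v) → cl C v ≡ i
  A-vertex-in-Cᵢ {v = v} indX (∣X∣≡s , load) v∈X v∈A with cl C v ≟ i
  ... | yes clv≡i = clv≡i
  ... | no  clv≢i = contradiction
    (subst (λ t → t + ∣ N C i ∣ + ∣ N C (fin0 i) ∣ ≤ 2 + ∣ UB S ∣) ∣X∣≡s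
      (off-cluster-bound C indX v∈X v∈A clv≢i load))
    (<⇒≱ excess)

  step : ∀ {X Y} → Invariant X → Step₂ (G S) X Y → Invariant Y
  step {X} {Y} inv@(∣X∣≡s , load) (indX , _ , u , v , X─Y≡u , Y─X≡v , d) =
    trans (sym (exchange-∣∣ X─Y≡u Y─X≡v)) ∣X∣≡s , load′
    where
    open ≤-Reasoning
    load-kept : (v ∈ U C i → u ∈ U C i) → ∣ Y ∩ U C i ∣ + ∣ N C i ∣ ≤ 1 + ∣ U C i ∣
    load-kept v∈Uᵢ⇒u∈Uᵢ =
      ≤-trans (+-monoˡ-≤ ∣ N C i ∣ (exchange-∣∩∣≤ X─Y≡u Y─X≡v (U C i) v∈Uᵢ⇒u∈Uᵢ)) load
    load′ : ∣ Y ∩ U C i ∣ + ∣ N C i ∣ ≤ 1 + ∣ U C i ∣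
    load′ with v ∈? U C i | A-or-UB S u
    ... | no  v∉Uᵢ | _        = load-kept (⊥-elim ∘ v∉Uᵢ)
    ... | yes v∈Uᵢ | inj₂ u∈B = load-kept λ _ →
      ∈U⁺ C u∈B (trans (Dist≤2⇒cl≡ C u∈B (proj₁ (∈U⁻ C v∈Uᵢ)) d) (proj₂ (∈U⁻ C v∈Uᵢ)))
    ... | yes _    | inj₁ u∈A = begin
      ∣ Y ∩ U C i ∣ + ∣ N C i ∣       ≤⟨ +-monoˡ-≤ ∣ N C i ∣ (exchange-∣∩∣≤1+ Y─X≡v (U C i)) ⟩
      1 + (∣ X ∩ U C i ∣ + ∣ N C i ∣) ≤⟨ s≤s (subst (λ j → ∣ X ∩ U C j ∣ + ∣ N C j ∣ ≤ ∣ U C j ∣)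
                                                 (A-vertex-in-Cᵢ indX inv u∈X u∈A)
                                                 (A-vertex-bound C indX u∈X u∈A)) ⟩
      1 + ∣ U C i ∣                   ∎
      where u∈X = p─q≡⁅x⁆⇒x∈p X─Y≡u

  invariant-along : ∀ {X Y} → Invariant X → Reach₂ (G S) X Y → Invariant Y
  invariant-along inv ε            = inv
  invariant-along inv (st ◅ path) = invariant-along (step inv st) path

  initial : ∀ {X} → Free C i X → ∣ X ∣ ≡ s → Invariant X
  initial {X} freeX ∣X∣≡s = ∣X∣≡s , ≤-trans (free-bound C {X = X} freeX) (n≤1+n _)

  final-absurd : ∀ {Y j} → Invariant Y → Typical S Y → Free C j Y → j ≢ i → ⊥
  final-absurd {Y} {j} (∣Y∣≡s , load) tyY freeY j≢i = <⇒≱ excess (begin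
    s + ∣ N C i ∣ + ∣ N C (fin0 i) ∣ ≡⟨ cong (λ t → t + ∣ N C i ∣ + ∣ N C (fin0 i) ∣) (sym ∣Y∣≡s) ⟩
    ∣ Y ∣ + ∣ N C i ∣ + ∣ N C (fin0 i) ∣ ≤⟨ +-monoʳ-≤ (∣ Y ∣ + ∣ N C i ∣) (∣N₀∣≤∣N∣ C i j) ⟩
    ∣ Y ∣ + ∣ N C i ∣ + ∣ N C j ∣ ≤⟨ ∣p∩r∣+a≤c+∣r∣⇒∣p∣+a+b≤c+∣q∣ Y (UB S) (U C i) (U⊆UB C) load
                                        (typical-free-bound C tyY freeY (U-disjoint C j≢i)) ⟩
    1 + ∣ UB S ∣ ≤⟨ n≤1+n _ ⟩
    2 + ∣ UB S ∣ ∎)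
    where open ≤-Reasoning

reach-bound : ∀ {S} (C : Clustering S) {Is It i j} → Typical S It →
  Free C i Is → Free C j It → j ≢ i → Reach₂ (G S) Is It →
  ∣ Is ∣ + ∣ N C i ∣ + ∣ N C (fin0 i) ∣ ≤ 2 + ∣ UB S ∣
reach-bound {S} C {Is} {i = i} tyIt freeIs freeIt j≢i path
  with ∣ Is ∣ + ∣ N C i ∣ + ∣ N C (fin0 i) ∣ ≤? 2 + ∣ UB S ∣
... | yes bound = bound
... | no  ¬bound =
  ⊥-elim (final-absurd (invariant-along (initial {Is} freeIs refl) path) tyIt freeIt j≢i)
  where open Excess C i ∣ Is ∣ (≰⇒> ¬bound)

a+p+q∸k≤u : ∀ {a p q u} → a + p ≤ u → q ≤ p → a + p + q ≤ 2 + u →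
  ∃[ k ] (k ≤ 2 × k ≤ p × a + p + q ∸ k ≤ u)
a+p+q∸k≤u {a} {p} {q} {u} a+p≤u q≤p a+p+q≤2+u =
  p ⊓ 2 , m⊓n≤n p 2 , m⊓n≤m p 2 , m≤n+o⇒m∸n≤o (a + p + q) (p ⊓ 2) (begin
    a + p + q         ≤⟨ ⊓-glb a+p+q≤p+u a+p+q≤2+u ⟩
    (p + u) ⊓ (2 + u) ≡⟨ sym (+-distribʳ-⊓ u p 2) ⟩
    p ⊓ 2 + u         ∎)
  where
  open ≤-Reasoning
  a+p+q≤p+u : a + p + q ≤ p + u
  a+p+q≤p+u = begin
    a + p + q ≤⟨ +-monoˡ-≤ q a+p≤u ⟩
    u + q     ≤⟨ +-monoʳ-≤ u q≤p ⟩
    u + p     ≡⟨ +-comm u p ⟩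
    p + u     ∎

free-reach-bound : ∀ {S} (C : Clustering S) {Is It is it} → Typical S Is → Typical S It →
  Free C is Is → Free C it It → is ≢ it → Reach₂ (G S) Is It →
  ∃[ k ] (k ≤ 2 × k ≤ ∣ N C is ∣ × ∣ Is ∣ + ∣ N C is ∣ + ∣ N C (fin0 is) ∣ ∸ k ≤ ∣ UB S ∣)
free-reach-bound C {is = is} tyIs tyIt freeIs freeIt is≢it path =
  a+p+q∸k≤u (typical-free⇒∣X∣+∣N∣≤∣UB∣ C tyIs freeIs) (∣N₀∣≤∣N∣ C is is)
    (reach-bound C tyIt freeIs freeIt (is≢it ∘ sym) path)

lemma7 : (S : SplitGraph) (C : Clustering S) (Is It : Subset (n (G S))) →
    Typical S Is → Typical S It →
    (is it : Fin (m C)) → IsFirstFree C Is is → IsFirstFree C It it → is ≢ it →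
    Reach₂ (G S) Is It →
    (∃[ k₁ ] (k₁ ≤ 2 × k₁ ≤ ∣ N C is ∣ × ∣ Is ∣ + ∣ N C is ∣ + ∣ N C (fin0 is) ∣ ∸ k₁ ≤ ∣ UB S ∣)) ×
    (∃[ k₂ ] (k₂ ≤ 2 × k₂ ≤ ∣ N C it ∣ × ∣ It ∣ + ∣ N C it ∣ + ∣ N C (fin0 it) ∣ ∸ k₂ ≤ ∣ UB S ∣))
-- Only Freeness of i(Is) and i(It) is used, not their minimality.
lemma7 S C Is It tyIs tyIt is it (freeIs , _) (freeIt , _) is≢it path =
  free-reach-bound C tyIs tyIt freeIs freeIt is≢it path ,
  free-reach-bound C tyIt tyIs freeIt freeIs (is≢it ∘ sym) (reverse (Step₂-sym {G S}) path)
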